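{- Let $n\geq1$ and $\tau$ be integers with $1\leq\tau<\lfloor n/2\rfloor$, and let $K_n$ be the complete graph on $n$ vertices. Then $\lceil\tau/10\rceil\leq \mathsf{c}^{\max}_{\tau}(K_n)\leq\tau$.
   Context: A multi-layer graph with designated layers is $(V,\{C_1,\dots,C_\tau\},R)$ with cop layers $C_i\subseteq\binom V2$ and robber layer $R\subseteq\binom V2$; $(V,\{C_1,\dots,C_\tau\},*)$ means $R=C_1\cup\dots\cup C_\tau$. Game with allocation $(k_1,\dots,k_\tau)$: $k_i$ cops assigned to layer $C_i$; cops placed first, then the robber; turns alternate starting with the cops; each cop stays or moves along one edge of its own layer, the robber stays or moves along one edge of $R$; cops win if a cop ever occupies the robber's vertex. The multi-layer cop number $\mathsf c(\mathcal G)$ is the least $k$ such that some allocation with $\sum_ik_i=k$ gives the cop player a winning strategy. For a connected simple graph $G=(V,E)$ and integer $\tau\geq1$, let $\mathcal{L}(G,\tau)$ be the set of all multi-layer graphs $(V,\{C_1,\dots,C_\tau\},*)$ with $C_1\cup\dots\cup C_\tau=E$ and each simple graph $(V,C_i)$ connected (layers may share edges). The extremal multi-layer cop number is $\mathsf{c}^{\max}_\tau(G)=\max_{\mathcal G\in\mathcal L(G,\tau)}\mathsf c(\mathcal G)$. -}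

module Defs where

open import Data.Nat using (ℕ; zero; suc; _≤_; _<_)
open import Data.Fin using (Fin; zero; suc)
open import Data.Bool using (Bool; true; false; _∨_; T)
open import Data.Vec using (Vec; lookup; sum)
open import Data.Product using (Σ; ∃; _×_; _,_)
open import Data.Sum using (_⊎_)
open import Relation.Nullary using (¬_)
open import Relation.Binary.PropositionalEquality using (_≡_; _≢_)
open import Relation.Binary.Construct.Closure.ReflexiveTransitive using (Star)

-- Edge sets on the vertex set V = Fin n.
-- A set of 2-subsets of V is encoded as a symmetric, irreflexive
-- Boolean relation: {u,v} ∈ E  iff  E u v ≡ true.

EdgeSet : ℕ → Set
EdgeSet n = Fin n → Fin n → Bool

IsEdgeSet : ∀ {n} → EdgeSet n → Set
IsEdgeSet {n} E = (∀ (u v : Fin n) → E u v ≡ E v u) × (∀ (u : Fin n) → E u u ≡ false)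

Adj : ∀ {n} → EdgeSet n → Fin n → Fin n → Set
Adj E u v = T (E u v)

Connected : ∀ {n} → EdgeSet n → Set
Connected {n} E = ∀ (u v : Fin n) → Star (Adj E) u v

anyFin : ∀ {τ} → (Fin τ → Bool) → Bool
anyFin {zero}  f = false
anyFin {suc τ} f = f zero ∨ anyFin (λ i → f (suc i))

⋃Layers : ∀ {n τ} → (Fin τ → EdgeSet n) → EdgeSet n
⋃Layers C u v = anyFin (λ i → C i u v)

record MultiLayer (n τ : ℕ) : Set where
  field
    cop : Fin τ → EdgeSet n
    rob : EdgeSet n

star : ∀ {n τ} → (Fin τ → EdgeSet n) → MultiLayer n τ
star C = record { cop = C ; rob = ⋃Layers C }

Step : ∀ {n} → EdgeSet n → Fin n → Fin n → Set
Step E u v = (u ≡ v) ⊎ Adj E u v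

-- An allocation (k₁,…,k_τ); its total number of cops is  sum a.
Allocation : ℕ → Set
Allocation τ = Vec ℕ τ

Cops : ∀ {τ} → ℕ → Allocation τ → Set
Cops {τ} n a = (i : Fin τ) → Fin (lookup a i) → Fin n

Captured : ∀ {n τ} (a : Allocation τ) → Cops n a → Fin n → Set
Captured {τ = τ} a c r = Σ (Fin τ) λ i → Σ (Fin (lookup a i)) λ j → c i j ≡ r

CopMove : ∀ {n τ} (G : MultiLayer n τ) (a : Allocation τ) → Cops n a → Cops n a → Set
CopMove G a c c' = ∀ i j → Step (MultiLayer.cop G i) (c i j) (c' i j)

-- CopWinFrom G a c r : in the position with cops at c, robber at r and
-- the cops to move, the cop player can force capture (in finitely many rounds).
data CopWinFrom {n τ} (G : MultiLayer n τ) (a : Allocation τ) : Cops n a → Fin n → Set where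
  move : ∀ {c r} (c' : Cops n a) → CopMove G a c c' →
         (Captured a c' r ⊎
          (∀ r' → Step (MultiLayer.rob G) r r' → Captured a c' r' ⊎ CopWinFrom G a c' r')) →
         CopWinFrom G a c r

-- the cop player has a winning strategy with allocation a:
-- cops are placed first, then the robber, then the cops move first.
CopsWin : ∀ {n τ} → MultiLayer n τ → Allocation τ → Set
CopsWin {n} G a = Σ (Cops n a) λ c₀ → ∀ (r₀ : Fin n) → Captured a c₀ r₀ ⊎ CopWinFrom G a c₀ r₀

CopNumber≥ : ∀ {n τ} → MultiLayer n τ → ℕ → Set
CopNumber≥ {τ = τ} G m = ∀ (a : Allocation τ) → sum a < m → ¬ CopsWin G a

CopNumber≤ : ∀ {n τ} → MultiLayer n τ → ℕ → Set
CopNumber≤ {τ = τ} G m = Σ (Allocation τ) λ a → sum a ≤ m × CopsWin G a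

InL-K : (n τ : ℕ) → (Fin τ → EdgeSet n) → Set
InL-K n τ C =
  (∀ i → IsEdgeSet (C i)) ×
  (∀ i → Connected (C i)) ×
  (∀ (u v : Fin n) → u ≢ v → Adj (⋃Layers C) u v)

CMaxK≥ : (n τ : ℕ) → ℕ → Set
CMaxK≥ n τ m = Σ (Fin τ → EdgeSet n) λ C → InL-K n τ C × CopNumber≥ (star C) m

CMaxK≤ : (n τ : ℕ) → ℕ → Set
CMaxK≤ n τ m = ∀ (C : Fin τ → EdgeSet n) → InL-K n τ C → CopNumber≤ (star C) m

-- Sort the vertices of Kₙ into τ levels 0,…,τ-1 (vertex x at level min(x, τ-1)) and
-- let layer i join two distinct vertices whose levels differ by at most 1 or by exactly i.
-- Every layer is connected and together they cover Kₙ.  A cop of layer i standing at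
-- level ℓ can reach in one move only the levels ℓ, ℓ ± 1 and ℓ ± i, so fewer than τ/6
-- cops leave some level unguarded after each of their moves; as τ ≤ n every level is
-- occupied, and the robber, who moves in Kₙ, jumps there.  Conversely one cop per
-- layer, all placed on one vertex, wins in one move, because the robber's vertex is
-- joined to that vertex in some layer.
module Submission where

open import Defs
open import Data.Nat using (ℕ; _≤_; _<_; _+_)
open import Data.Nat.DivMod using (_/_)
open import Data.Product using (_×_)

open import Data.Bool using (Bool; false; T)
open import Data.Bool.Properties using (T-∨)
open import Data.Fin as Fin using (Fin; toℕ; fromℕ<)
open import Data.Fin.Properties using (toℕ-fromℕ<; fromℕ<-toℕ; toℕ<n; toℕ-injective; injective⇒≤; ¬∀⟶∃¬)
open import Data.List as List using (List; []; _∷_; _++_; length; concatMap)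
open import Data.List.Membership.DecPropositional Data.Nat._≟_ using (_∈?_)
open import Data.List.Membership.Propositional using (_∈_; _∉_)
open import Data.List.Membership.Propositional.Properties using (∈-++⁺ˡ; ∈-++⁺ʳ; ∈-concat⁺′; ∈-map⁺)
open import Data.List.Properties using (length-++)
open import Data.List.Relation.Unary.Any using (here; there; index)
open import Data.List.Relation.Unary.Any.Properties using (lookup-index)
open import Data.Nat using (zero; suc; _∸_; _*_; _⊓_; ∣_-_∣; z≤n; s≤s; s≤s⁻¹; _≤?_)
open import Data.Nat.DivMod using (m/n*n≤m; m/n≤m)
open import Data.Nat.Properties
open import Data.Product using (∃; ∃₂; _,_)
open import Data.Sum using (_⊎_; inj₁; inj₂)
open import Data.Vec using ([]; _∷_; lookup; sum; replicate)
open import Data.Vec.Properties using (lookup-replicate)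
open import Function using (_∘_; mk⇔; Equivalence)
open import Relation.Binary.Construct.Closure.ReflexiveTransitive as Star using (Star; ε; _◅_; _◅◅_)
open import Relation.Binary.PropositionalEquality
open import Relation.Nullary using (¬_; Dec; yes; no; does; ¬?; contradiction)
open import Relation.Nullary.Decidable
  using (⌊_⌋; isYes≗does; toWitness; fromWitness; _×-dec_; _⊎-dec_; dec-false; does-⇔; T?)

T-anyFin⁺ : ∀ {τ} (f : Fin τ → Bool) i → T (f i) → T (anyFin f)
T-anyFin⁺ f Fin.zero    fi = Equivalence.from T-∨ (inj₁ fi)
T-anyFin⁺ f (Fin.suc i) fi = Equivalence.from T-∨ (inj₂ (T-anyFin⁺ (f ∘ Fin.suc) i fi))

T-anyFin⁻ : ∀ {τ} (f : Fin τ → Bool) → T (anyFin f) → ∃ λ i → T (f i)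
T-anyFin⁻ {suc τ} f any with Equivalence.to T-∨ any
... | inj₁ f0 = Fin.zero , f0
... | inj₂ rest with T-anyFin⁻ (f ∘ Fin.suc) rest
...   | i , fi = Fin.suc i , fi

module _ {n τ} (G : MultiLayer n τ) (a : Allocation τ) where
  open MultiLayer G

  Guarded : Cops n a → Fin n → Set
  Guarded c y = ∃₂ λ i j → Step (cop i) (c i j) y

  captured⇒guarded : ∀ {c r} → Captured a c r → Guarded c r
  captured⇒guarded (i , j , c≡r) = i , j , inj₁ c≡r

  robber-evades : (∀ r r' → Step rob r r') → (∀ c → ∃ λ r → ¬ Guarded c r) → ¬ CopsWin G a
  robber-evades roam unguarded (c₀ , win₀) with unguarded c₀
  ... | r₀ , ¬g₀ with win₀ r₀
  ...   | inj₁ cap = ¬g₀ (captured⇒guarded cap)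
  ...   | inj₂ win = evades ¬g₀ win
    where
    evades : ∀ {c r} → ¬ Guarded c r → ¬ CopWinFrom G a c r
    evades ¬g (move c' mv (inj₁ (i , j , c'≡r))) = ¬g (i , j , subst (Step (cop i) _) c'≡r (mv i j))
    evades {r = r} ¬g (move c' mv (inj₂ next)) with unguarded c'
    ... | r' , ¬g' with next r' (roam r r')
    ...   | inj₁ cap = ¬g' (captured⇒guarded cap)
    ...   | inj₂ win = evades ¬g' win

sum-replicate-1 : ∀ τ → sum (replicate τ 1) ≡ τ
sum-replicate-1 zero    = refl
sum-replicate-1 (suc τ) = cong suc (sum-replicate-1 τ)

module _ {n t} (G : MultiLayer n (suc t)) where
  open MultiLayer G

  oneCopPerLayer-wins : (v₀ : Fin n) → (∀ r → r ≢ v₀ → ∃ λ i → Adj (cop i) v₀ r) →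
                        CopsWin G (replicate (suc t) 1)
  oneCopPerLayer-wins v₀ reach = (λ _ _ → v₀) , first-move
    where
    theCop : ∀ i → Fin (lookup (replicate (suc t) 1) i)
    theCop i = subst Fin (sym (lookup-replicate i 1)) Fin.zero

    first-move : ∀ r → Captured (replicate (suc t) 1) (λ _ _ → v₀) r
                     ⊎ CopWinFrom G (replicate (suc t) 1) (λ _ _ → v₀) r
    first-move r with r Fin.≟ v₀
    ... | yes refl = inj₁ (Fin.zero , theCop Fin.zero , refl)
    ... | no r≢v₀  with reach r r≢v₀
    ...   | i , v₀~r = inj₂ (move pounce pounce-legal (inj₁ (i , theCop i , pounce-hits)))
      where
      pounce : Cops n (replicate (suc t) 1)
      pounce i' _ with T? (cop i' v₀ r)
      ... | yes _ = r
      ... | no _  = v₀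

      pounce-legal : CopMove G (replicate (suc t) 1) (λ _ _ → v₀) pounce
      pounce-legal i' _ with T? (cop i' v₀ r)
      ... | yes v₀~r' = inj₂ v₀~r'
      ... | no _      = inj₁ refl

      pounce-hits : pounce i (theCop i) ≡ r
      pounce-hits with T? (cop i v₀ r)
      ... | yes _     = refl
      ... | no v₀≁r = contradiction v₀~r v₀≁r

module _ {A : Set} where

  concatFin : ∀ k → (Fin k → List A) → List A
  concatFin zero    f = []
  concatFin (suc k) f = f Fin.zero ++ concatFin k (f ∘ Fin.suc)

  ∈-concatFin⁺ : ∀ k f j {x} → x ∈ f j → x ∈ concatFin k f
  ∈-concatFin⁺ (suc k) f Fin.zero    x∈ = ∈-++⁺ˡ x∈
  ∈-concatFin⁺ (suc k) f (Fin.suc j) x∈ = ∈-++⁺ʳ (f Fin.zero) (∈-concatFin⁺ k (f ∘ Fin.suc) j x∈)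

  length-concatFin : ∀ k f {ℓ} → (∀ j → length (f j) ≡ ℓ) → length (concatFin k f) ≡ k * ℓ
  length-concatFin zero    f eq = refl
  length-concatFin (suc k) f eq = trans (length-++ (f Fin.zero))
    (cong₂ _+_ (eq Fin.zero) (length-concatFin k (f ∘ Fin.suc) (eq ∘ Fin.suc)))

  concatCops : ∀ {τ} (a : Allocation τ) → ((i : Fin τ) → Fin (lookup a i) → List A) → List A
  concatCops []      f = []
  concatCops (k ∷ a) f = concatFin k (f Fin.zero) ++ concatCops a (f ∘ Fin.suc)

  ∈-concatCops⁺ : ∀ {τ} (a : Allocation τ) f i j {x} → x ∈ f i j → x ∈ concatCops a f
  ∈-concatCops⁺ (k ∷ a) f Fin.zero    j x∈ = ∈-++⁺ˡ (∈-concatFin⁺ k (f Fin.zero) j x∈)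
  ∈-concatCops⁺ (k ∷ a) f (Fin.suc i) j x∈ =
    ∈-++⁺ʳ (concatFin k (f Fin.zero)) (∈-concatCops⁺ a (f ∘ Fin.suc) i j x∈)

  length-concatCops : ∀ {τ} (a : Allocation τ) f {ℓ} → (∀ i j → length (f i j) ≡ ℓ) →
                      length (concatCops a f) ≡ sum a * ℓ
  length-concatCops []      f eq = refl
  length-concatCops (k ∷ a) f {ℓ} eq = begin
    length (concatFin k (f Fin.zero) ++ concatCops a (f ∘ Fin.suc))
      ≡⟨ length-++ (concatFin k (f Fin.zero)) ⟩
    length (concatFin k (f Fin.zero)) + length (concatCops a (f ∘ Fin.suc))
      ≡⟨ cong₂ _+_ (length-concatFin k (f Fin.zero) (eq Fin.zero)) (length-concatCops a (f ∘ Fin.suc) (eq ∘ Fin.suc)) ⟩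
    k * ℓ + sum a * ℓ
      ≡⟨ *-distribʳ-+ ℓ k (sum a) ⟨
    (k + sum a) * ℓ ∎
    where open ≡-Reasoning

∃-∉-short : ∀ {τ} (xs : List ℕ) → length xs < τ → ∃ λ (c : Fin τ) → toℕ c ∉ xs
∃-∉-short {τ} xs short = ¬∀⟶∃¬ τ (λ c → toℕ c ∈ xs) (λ c → toℕ c ∈? xs) ¬covers
  where
  ¬covers : ¬ (∀ c → toℕ c ∈ xs)
  ¬covers covers = <⇒≱ short (injective⇒≤ {f = index ∘ covers} position-injective)
    where
    position-injective : ∀ {c d} → index (covers c) ≡ index (covers d) → c ≡ d
    position-injective {c} {d} eq = toℕ-injective (begin
      toℕ c                             ≡⟨ lookup-index (covers c) ⟩
      List.lookup xs (index (covers c)) ≡⟨ cong (List.lookup xs) eq ⟩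
      List.lookup xs (index (covers d)) ≡⟨ lookup-index (covers d) ⟨
      toℕ d                             ∎)
      where open ≡-Reasoning

∣[1+k]⊓n-k⊓n∣≤1 : ∀ k n → ∣ suc k ⊓ n - k ⊓ n ∣ ≤ 1
∣[1+k]⊓n-k⊓n∣≤1 zero    zero    = z≤n
∣[1+k]⊓n-k⊓n∣≤1 zero    (suc n) = s≤s z≤n
∣[1+k]⊓n-k⊓n∣≤1 (suc k) zero    = z≤n
∣[1+k]⊓n-k⊓n∣≤1 (suc k) (suc n) = ∣[1+k]⊓n-k⊓n∣≤1 k n

_±_ : ℕ → ℕ → List ℕ
m ± d = m + d ∷ m ∸ d ∷ []

n∈m±∣m-n∣ : ∀ m n → n ∈ m ± ∣ m - n ∣
n∈m±∣m-n∣ m n with ≤-total m n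
... | inj₁ m≤n = here (trans (sym (m+[n∸m]≡n m≤n)) (cong (m +_) (sym (m≤n⇒∣m-n∣≡n∸m m≤n))))
... | inj₂ n≤m = there (here (trans (sym (m∸[m∸n]≡n n≤m)) (cong (m ∸_) (sym (m≤n⇒∣n-m∣≡n∸m n≤m)))))

m<[n+9]/10⇒m*10<n : ∀ m n → m < (n + 9) / 10 → m * 10 < n
m<[n+9]/10⇒m*10<n m n m<⌈n/10⌉ = +-cancelˡ-≤ 9 _ _ (begin
  9 + suc (m * 10)  ≡⟨⟩
  suc m * 10        ≤⟨ *-monoˡ-≤ 10 m<⌈n/10⌉ ⟩
  (n + 9) / 10 * 10 ≤⟨ m/n*n≤m (n + 9) 10 ⟩
  n + 9             ≡⟨ +-comm n 9 ⟩
  9 + n             ∎)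
  where open ≤-Reasoning

covers⇒step : ∀ {n} {E : EdgeSet n} → (∀ u v → u ≢ v → Adj E u v) → ∀ u v → Step E u v
covers⇒step cover u v with u Fin.≟ v
... | yes u≡v = inj₁ u≡v
... | no  u≢v = inj₂ (cover u v u≢v)

-- n = suc m vertices, τ = suc t layers, levels 0,…,t.
module Levels (m t : ℕ) where

  level : Fin (suc m) → ℕ
  level x = toℕ x ⊓ t

  gap : Fin (suc m) → Fin (suc m) → ℕ
  gap x y = ∣ level x - level y ∣

  Linked : Fin (suc t) → Fin (suc m) → Fin (suc m) → Set
  Linked i x y = x ≢ y × (gap x y ≤ 1 ⊎ gap x y ≡ toℕ i)

  linked? : ∀ i x y → Dec (Linked i x y)
  linked? i x y = ¬? (x Fin.≟ y) ×-dec (gap x y ≤? 1 ⊎-dec gap x y ≟ toℕ i)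

  layer : Fin (suc t) → EdgeSet (suc m)
  layer i x y = ⌊ linked? i x y ⌋

  linked-sym : ∀ {i x y} → Linked i x y → Linked i y x
  linked-sym {x = x} {y} (x≢y , close) rewrite ∣-∣-comm (level x) (level y) = x≢y ∘ sym , close

  adj⇒linked : ∀ {i x y} → Adj (layer i) x y → Linked i x y
  adj⇒linked = toWitness

  linked⇒adj : ∀ {i x y} → Linked i x y → Adj (layer i) x y
  linked⇒adj = fromWitness

  layer-isEdgeSet : ∀ i → IsEdgeSet (layer i)
  layer-isEdgeSet i = symmetric , irreflexive
    where
    symmetric : ∀ x y → layer i x y ≡ layer i y x
    symmetric x y = begin
      ⌊ linked? i x y ⌋ ≡⟨ isYes≗does (linked? i x y) ⟩
      does (linked? i x y) ≡⟨ does-⇔ (mk⇔ linked-sym linked-sym) (linked? i x y) (linked? i y x) ⟩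
      does (linked? i y x) ≡⟨ isYes≗does (linked? i y x) ⟨
      ⌊ linked? i y x ⌋ ∎
      where open ≡-Reasoning

    irreflexive : ∀ x → layer i x x ≡ false
    irreflexive x = trans (isYes≗does (linked? i x x)) (dec-false (linked? i x x) λ (x≢x , _) → x≢x refl)

  descend : ∀ i k (k<n : k < suc m) → Star (Adj (layer i)) (fromℕ< k<n) Fin.zero
  descend i zero    _   = ε
  descend i (suc k) k+1<n = linked⇒adj (x≢y , inj₁ close) ◅ descend i k k<n
    where
    k<n : k < suc m
    k<n = <-trans (n<1+n k) k+1<n

    x≢y : fromℕ< k+1<n ≢ fromℕ< k<n
    x≢y eq = 1+n≢n (trans (sym (toℕ-fromℕ< k+1<n)) (trans (cong toℕ eq) (toℕ-fromℕ< k<n)))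

    close : gap (fromℕ< k+1<n) (fromℕ< k<n) ≤ 1
    close rewrite toℕ-fromℕ< k+1<n | toℕ-fromℕ< k<n = ∣[1+k]⊓n-k⊓n∣≤1 k t

  layer-connected : ∀ i → Connected (layer i)
  layer-connected i x y = to-zero x ◅◅ Star.reverse (linked⇒adj ∘ linked-sym ∘ adj⇒linked) (to-zero y)
    where
    to-zero : ∀ x → Star (Adj (layer i)) x Fin.zero
    to-zero x = subst (λ z → Star (Adj (layer i)) z Fin.zero) (fromℕ<-toℕ x (toℕ<n x))
                      (descend i (toℕ x) (toℕ<n x))

  layers-cover : ∀ x y → x ≢ y → Adj (⋃Layers layer) x y
  layers-cover x y x≢y =
    T-anyFin⁺ (λ i → layer i x y) (fromℕ< gap<τ) (linked⇒adj (x≢y , inj₂ (sym (toℕ-fromℕ< gap<τ))))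
    where
    gap<τ : gap x y < suc t
    gap<τ = s≤s (≤-trans (∣m-n∣≤m⊔n (level x) (level y)) (⊔-lub (m⊓n≤n (toℕ x) t) (m⊓n≤n (toℕ y) t)))

  level-fromℕ< : ∀ {ℓ} (ℓ<n : ℓ < suc m) → ℓ ≤ t → level (fromℕ< ℓ<n) ≡ ℓ
  level-fromℕ< ℓ<n ℓ≤t = trans (cong (_⊓ t) (toℕ-fromℕ< ℓ<n)) (m≤n⇒m⊓n≡m ℓ≤t)

  reachableLevels : ℕ → Fin (suc t) → List ℕ
  reachableLevels ℓ i = concatMap (ℓ ±_) (0 ∷ 1 ∷ toℕ i ∷ [])

  step⇒gap∈ : ∀ {i x y} → Step (layer i) x y → gap x y ∈ 0 ∷ 1 ∷ toℕ i ∷ []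
  step⇒gap∈ {x = x} (inj₁ refl) = here (∣n-n∣≡0 (level x))
  step⇒gap∈ (inj₂ adj) with adj⇒linked adj
  ... | _ , inj₂ gap≡i = there (there (here gap≡i))
  ... | _ , inj₁ gap≤1 = ≤1⇒∈ gap≤1
    where
    ≤1⇒∈ : ∀ {d ds} → d ≤ 1 → d ∈ 0 ∷ 1 ∷ ds
    ≤1⇒∈ z≤n       = here refl
    ≤1⇒∈ (s≤s z≤n) = there (here refl)

  step⇒level∈reachable : ∀ {i x y} → Step (layer i) x y → level y ∈ reachableLevels (level x) i
  step⇒level∈reachable {x = x} {y} st =
    ∈-concat⁺′ (n∈m±∣m-n∣ (level x) (level y)) (∈-map⁺ (level x ±_) (step⇒gap∈ st))

  module _ (a : Allocation (suc t)) where

    guardedLevels : Cops (suc m) a → List ℕ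
    guardedLevels c = concatCops a (λ i j → reachableLevels (level (c i j)) i)

    length-guardedLevels : ∀ c → length (guardedLevels c) ≡ sum a * 6
    length-guardedLevels c = length-concatCops a _ λ _ _ → refl

    guarded⇒level∈ : ∀ {c y} → Guarded (star layer) a c y → level y ∈ guardedLevels c
    guarded⇒level∈ (i , j , st) = ∈-concatCops⁺ a _ i j (step⇒level∈reachable st)

    few-cops-lose : suc t ≤ suc m → sum a * 6 < suc t → ¬ CopsWin (star layer) a
    few-cops-lose τ≤n few = robber-evades (star layer) a (covers⇒step layers-cover) unguarded
      where
      unguarded : ∀ c → ∃ λ r → ¬ Guarded (star layer) a c r
      unguarded c with ∃-∉-short (guardedLevels c) (subst (_< suc t) (sym (length-guardedLevels c)) few)
      ... | ℓ , ℓ∉ = fromℕ< ℓ<n , ℓ∉ ∘ subst (_∈ guardedLevels c) level≡ℓ ∘ guarded⇒level∈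
        where
        ℓ<n : toℕ ℓ < suc m
        ℓ<n = <-≤-trans (toℕ<n ℓ) τ≤n

        level≡ℓ : level (fromℕ< ℓ<n) ≡ toℕ ℓ
        level≡ℓ = level-fromℕ< ℓ<n (s≤s⁻¹ (toℕ<n ℓ))

theorem5p6 : ∀ (n τ : ℕ) → 1 ≤ n → 1 ≤ τ → τ < n / 2 →
    CMaxK≥ n τ ((τ + 9) / 10) × CMaxK≤ n τ τ
theorem5p6 (suc m) (suc t) (s≤s z≤n) (s≤s z≤n) τ<n/2 = lower , upper
  where
  open Levels m t

  τ≤n : suc t ≤ suc m
  τ≤n = ≤-trans (<⇒≤ τ<n/2) (m/n≤m (suc m) 2)

  lower : CMaxK≥ (suc m) (suc t) ((suc t + 9) / 10)
  lower = layer , (layer-isEdgeSet , layer-connected , layers-cover) , λ a few →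
    few-cops-lose a τ≤n (≤-<-trans (*-monoʳ-≤ (sum a) (m≤m+n 6 4)) (m<[n+9]/10⇒m*10<n (sum a) (suc t) few))

  upper : CMaxK≤ (suc m) (suc t) (suc t)
  upper C (_ , _ , cover) = replicate (suc t) 1 , ≤-reflexive (sum-replicate-1 (suc t)) ,
    oneCopPerLayer-wins (star C) Fin.zero λ r r≢0 → T-anyFin⁻ (λ i → C i Fin.zero r) (cover Fin.zero r (r≢0 ∘ sym))
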